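{- Let $n\ge 6$ and let $H$ be an intersecting $3$-graph on $n$ vertices. If $H$ has a vertex $x$ such that $H-x$ has at most two edges, then $H$ is contained in one of $H(n),H_0(n),H_1(n),H_2(n),H_4(n)$.
   Context: A $3$-graph is a family of $3$-element subsets (edges) of a finite vertex set; intersecting means every two edges intersect. $H-x$ denotes the set of edges of $H$ not containing $x$. "$H$ is contained in $K$" means the special vertices of $K$ can be chosen among the vertices of $H$ so that every edge of $H$ is an edge of $K$. Constructions on an $n$-element vertex set: $H(n)$: all triples containing a fixed vertex. $H_0(n)$: special vertices $x,x_1,x_2$; all triples containing at least two of them. $H_1(n)$: special vertices $x,x_1,x_2,y_1$; all triples containing $\{x,x_1\}$, $\{x,x_2\}$ or $\{x,y_1\}$, plus $\{x_1,x_2,y_1\}$. $H_2(n)$: special vertices $x,x_1,x_2,y_1,y_2$; all triples containing $\{x,x_1\}$ or $\{x,x_2\}$, plus $\{x_1,x_2,y_1\},\{x_1,x_2,y_2\},\{x,y_1,y_2\}$. $H_4(n)$: special vertices $v_1,v_2,a,a',b,b'$; all triples containing $\{v_1,v_2\}$, plus $v_1aa', v_1bb', v_2ab, v_2ab', v_2a'b, v_2a'b'$. -}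

module Defs where

open import Data.Nat using (ℕ)
open import Data.Bool using (Bool; true)
open import Data.Fin using (Fin)
open import Data.Fin.Subset using (Subset; _∈_; _∉_; _∩_; _∪_; ⁅_⁆; ∣_∣; Nonempty)
open import Data.List using (List; []; _∷_)
open import Data.List.Relation.Unary.Unique.Propositional using (Unique)
open import Data.Product using (_×_; ∃-syntax)
open import Data.Sum using (_⊎_)
open import Relation.Binary.PropositionalEquality using (_≡_)

Family : ℕ → Set
Family n = Subset n → Bool

IsEdge : ∀ {n} → Family n → Subset n → Set
IsEdge H e = H e ≡ true

Is3Graph : ∀ {n} → Family n → Set
Is3Graph H = ∀ e → IsEdge H e → ∣ e ∣ ≡ 3

Intersecting : ∀ {n} → Family n → Set
Intersecting H = ∀ e f → IsEdge H e → IsEdge H f → Nonempty (e ∩ f)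

EdgeOfMinus : ∀ {n} → Family n → Fin n → Subset n → Set
EdgeOfMinus H x e = IsEdge H e × x ∉ e

AtMostTwo : ∀ {n} → (Subset n → Set) → Set
AtMostTwo P = ∀ e₁ e₂ e₃ → P e₁ → P e₂ → P e₃ → e₁ ≡ e₂ ⊎ e₁ ≡ e₃ ⊎ e₂ ≡ e₃

triple : ∀ {n} → Fin n → Fin n → Fin n → Subset n
triple a b c = ⁅ a ⁆ ∪ ⁅ b ⁆ ∪ ⁅ c ⁆

-- edges of the constructions (as predicates on 3-element sets e), given the special vertices
inH : ∀ {n} → Fin n → Subset n → Set
inH x e = x ∈ e

inH₀ : ∀ {n} → Fin n → Fin n → Fin n → Subset n → Set
inH₀ x x₁ x₂ e = (x ∈ e × x₁ ∈ e) ⊎ (x ∈ e × x₂ ∈ e) ⊎ (x₁ ∈ e × x₂ ∈ e)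

inH₁ : ∀ {n} → Fin n → Fin n → Fin n → Fin n → Subset n → Set
inH₁ x x₁ x₂ y₁ e =
  (x ∈ e × x₁ ∈ e) ⊎ (x ∈ e × x₂ ∈ e) ⊎ (x ∈ e × y₁ ∈ e) ⊎ e ≡ triple x₁ x₂ y₁

inH₂ : ∀ {n} → Fin n → Fin n → Fin n → Fin n → Fin n → Subset n → Set
inH₂ x x₁ x₂ y₁ y₂ e =
  (x ∈ e × x₁ ∈ e) ⊎ (x ∈ e × x₂ ∈ e) ⊎
  e ≡ triple x₁ x₂ y₁ ⊎ e ≡ triple x₁ x₂ y₂ ⊎ e ≡ triple x y₁ y₂

inH₄ : ∀ {n} → Fin n → Fin n → Fin n → Fin n → Fin n → Fin n → Subset n → Set
inH₄ v₁ v₂ a a' b b' e =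
  (v₁ ∈ e × v₂ ∈ e) ⊎
  e ≡ triple v₁ a a' ⊎ e ≡ triple v₁ b b' ⊎
  e ≡ triple v₂ a b ⊎ e ≡ triple v₂ a b' ⊎ e ≡ triple v₂ a' b ⊎ e ≡ triple v₂ a' b'

-- "H is contained in K": distinct special vertices chosen in the vertex set of H
-- such that every edge of H is an edge of K.
ContainedInH : ∀ {n} → Family n → Set
ContainedInH {n} H = ∃[ x ] (∀ e → IsEdge H e → inH x e)

ContainedInH₀ : ∀ {n} → Family n → Set
ContainedInH₀ {n} H = ∃[ x ] ∃[ x₁ ] ∃[ x₂ ]
  (Unique (x ∷ x₁ ∷ x₂ ∷ []) × (∀ e → IsEdge H e → inH₀ x x₁ x₂ e))

ContainedInH₁ : ∀ {n} → Family n → Set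
ContainedInH₁ {n} H = ∃[ x ] ∃[ x₁ ] ∃[ x₂ ] ∃[ y₁ ]
  (Unique (x ∷ x₁ ∷ x₂ ∷ y₁ ∷ []) × (∀ e → IsEdge H e → inH₁ x x₁ x₂ y₁ e))

ContainedInH₂ : ∀ {n} → Family n → Set
ContainedInH₂ {n} H = ∃[ x ] ∃[ x₁ ] ∃[ x₂ ] ∃[ y₁ ] ∃[ y₂ ]
  (Unique (x ∷ x₁ ∷ x₂ ∷ y₁ ∷ y₂ ∷ []) × (∀ e → IsEdge H e → inH₂ x x₁ x₂ y₁ y₂ e))

ContainedInH₄ : ∀ {n} → Family n → Set
ContainedInH₄ {n} H = ∃[ v₁ ] ∃[ v₂ ] ∃[ a ] ∃[ a' ] ∃[ b ] ∃[ b' ]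
  (Unique (v₁ ∷ v₂ ∷ a ∷ a' ∷ b ∷ b' ∷ []) × (∀ e → IsEdge H e → inH₄ v₁ v₂ a a' b b' e))

module Submission where

-- Let E be the set of edges of H avoiding x; by hypothesis E has at most two
-- members, and every edge outside E contains x.
-- * E = ∅: every edge contains x, so H is contained in H(n) with centre x.
-- * E = {A}, A = {a,b,c}: an edge through x meets A, so it contains one of
--   the pairs xa, xb, xc; hence H is contained in H₁(n) with x, a, b, c.
-- * E = {A,B}: A and B meet in a vertex y.  If they share a second vertex q,
--   say A = {y,q,r} and B = {y,q,s}, an edge through x missing y and q meets
--   A in r and B in s, so it is xrs: H is contained in H₂(n) with x, y, q, r, s.
--   Otherwise A = {y,a,a'}, B = {y,b,b'} with a, a', b, b' distinct, and an
--   edge through x missing y is one of xab, xab', xa'b, xa'b': H is contained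
--   in H₄(n) with v₁ = y, v₂ = x.

open import Defs
open import Data.Nat using (ℕ; suc; _≤_; z≤n; s≤s)
open import Data.Nat.Properties using (suc-injective; ≤-trans; <-irrefl)
open import Data.Fin using (Fin; suc; _≟_)
open import Data.Fin.Subset using (Subset; _∈_; _∉_; _∪_; _─_; _-_; ⁅_⁆; ∣_∣)
open import Data.Fin.Subset.Properties
  using ( _∈?_; nonempty?; Empty-unique; ∣⊥∣≡0; p─⊥≡p; p─q⊆p
        ; x∈p∧x≢y⇒x∈p-y; x∈p⇒∣p-x∣<∣p∣; x∈⁅x⁆; x∈⁅y⁆⇒x≡y; x∈p∩q⁻; x∈p∪q⁺; x∈p∪q⁻
        ; ⊆-antisym; anySubset?)
open import Data.Bool using (true; false)
import Data.Bool as Bool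
open import Data.Vec using (_∷_; here; there)
open import Data.Vec.Properties using (≡-dec)
open import Data.List using (List; []; _∷_; length)
open import Data.List.Relation.Unary.All as All using (All; []; _∷_)
open import Data.List.Relation.Unary.AllPairs using ([]; _∷_)
open import Data.List.Relation.Unary.Unique.Propositional using (Unique)
open import Data.Product using (_×_; _,_; ∃-syntax; proj₁)
open import Data.Sum using (_⊎_; inj₁; inj₂)
open import Relation.Nullary using (yes; no; ¬?; contradiction)
open import Relation.Nullary.Decidable using (_×-dec_; decidable-stable)
open import Relation.Unary using (Decidable)
open import Relation.Binary.PropositionalEquality
  using (_≡_; _≢_; refl; sym; trans; cong; subst; ≢-sym)

∣p∣≡1+∣p-x∣ : ∀ {n} {x : Fin n} {p : Subset n} → x ∈ p → ∣ p ∣ ≡ suc ∣ p - x ∣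
∣p∣≡1+∣p-x∣ {p = true ∷ q} here = cong suc (cong ∣_∣ (sym (p─⊥≡p q)))
∣p∣≡1+∣p-x∣ {x = suc _} {p = true ∷ _} (there m) = cong suc (∣p∣≡1+∣p-x∣ m)
∣p∣≡1+∣p-x∣ {x = suc _} {p = false ∷ _} (there m) = ∣p∣≡1+∣p-x∣ m

removeMember : ∀ {n k} {x : Fin n} {p : Subset n} → x ∈ p → ∣ p ∣ ≡ suc k → ∣ p - x ∣ ≡ k
removeMember x∈p size = suc-injective (trans (sym (∣p∣≡1+∣p-x∣ x∈p)) size)

x∈p─q⇒x∉q : ∀ {n} (p q : Subset n) {x : Fin n} → x ∈ p ─ q → x ∉ q
x∈p─q⇒x∉q (_ ∷ p) (_ ∷ q) (there m) (there m') = x∈p─q⇒x∉q p q m m'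

x∈p-y⇒x≢y : ∀ {n} {p : Subset n} {x y : Fin n} → x ∈ p - y → x ≢ y
x∈p-y⇒x≢y {p = p} {y = y} m refl = x∈p─q⇒x∉q p ⁅ y ⁆ m (x∈⁅x⁆ y)

member : ∀ {n k} (p : Subset n) → ∣ p ∣ ≡ suc k → ∃[ a ] a ∈ p
member {n} p size with nonempty? p
... | yes nonempty = nonempty
... | no empty =
  contradiction (trans (sym size) (trans (cong ∣_∣ (Empty-unique empty)) (∣⊥∣≡0 n))) λ ()

distinct≤∣p∣ : ∀ {n} {p : Subset n} {xs : List (Fin n)} →
  Unique xs → All (_∈ p) xs → length xs ≤ ∣ p ∣
distinct≤∣p∣ [] [] = z≤n
distinct≤∣p∣ {p = p} {x ∷ xs} (x≢xs ∷ unique) (x∈p ∷ xs⊆p) =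
  ≤-trans (s≤s (distinct≤∣p∣ unique xs⊆p-x)) (x∈p⇒∣p-x∣<∣p∣ x∈p)
  where
  xs⊆p-x : All (_∈ p - x) xs
  xs⊆p-x = All.zipWith (λ (y∈p , x≢y) → x∈p∧x≢y⇒x∈p-y y∈p (≢-sym x≢y)) (xs⊆p , x≢xs)

record IsTriple {n} (e : Subset n) (a b c : Fin n) : Set where
  constructor isTriple
  field
    ≢₁₂ : a ≢ b
    ≢₁₃ : a ≢ c
    ≢₂₃ : b ≢ c
    ∈₁ : a ∈ e
    ∈₂ : b ∈ e
    ∈₃ : c ∈ e
    covers : ∀ {z} → z ∈ e → z ≡ a ⊎ z ≡ b ⊎ z ≡ c

-- Three distinct members of a set of size 3 enumerate it: a fourth member
-- would give four distinct elements in a set of size 3.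
fromSize3 : ∀ {n} {e : Subset n} {a b c : Fin n} → ∣ e ∣ ≡ 3 →
  a ≢ b → a ≢ c → b ≢ c → a ∈ e → b ∈ e → c ∈ e → IsTriple e a b c
fromSize3 {e = e} {a} {b} {c} size a≢b a≢c b≢c a∈e b∈e c∈e =
  isTriple a≢b a≢c b≢c a∈e b∈e c∈e covers
  where
  covers : ∀ {z} → z ∈ e → z ≡ a ⊎ z ≡ b ⊎ z ≡ c
  covers {z} z∈e with z ≟ a | z ≟ b | z ≟ c
  ... | yes z≡a | _ | _ = inj₁ z≡a
  ... | no _ | yes z≡b | _ = inj₂ (inj₁ z≡b)
  ... | no _ | no _ | yes z≡c = inj₂ (inj₂ z≡c)
  ... | no z≢a | no z≢b | no z≢c = contradiction four≤3 (<-irrefl refl)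
    where
    four≤3 : 4 ≤ 3
    four≤3 = subst (4 ≤_) size (distinct≤∣p∣
      ((z≢a ∷ z≢b ∷ z≢c ∷ []) ∷ (a≢b ∷ a≢c ∷ []) ∷ (b≢c ∷ []) ∷ [] ∷ [])
      (z∈e ∷ a∈e ∷ b∈e ∷ c∈e ∷ []))

enumerateFrom : ∀ {n} {e : Subset n} {a : Fin n} → ∣ e ∣ ≡ 3 → a ∈ e →
  ∃[ b ] ∃[ c ] IsTriple e a b c
enumerateFrom {e = e} {a} size a∈e with member (e - a) (removeMember a∈e size)
... | b , b∈e-a with member (e - a - b) (removeMember b∈e-a (removeMember a∈e size))
... | c , c∈e-a-b = b , c , fromSize3 size
  (≢-sym (x∈p-y⇒x≢y b∈e-a)) (≢-sym (x∈p-y⇒x≢y c∈e-a)) (≢-sym (x∈p-y⇒x≢y c∈e-a-b))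
  a∈e (p─q⊆p e ⁅ a ⁆ b∈e-a) (p─q⊆p e ⁅ a ⁆ c∈e-a)
  where
  c∈e-a : c ∈ e - a
  c∈e-a = p─q⊆p (e - a) ⁅ b ⁆ c∈e-a-b

enumerate : ∀ {n} {e : Subset n} → ∣ e ∣ ≡ 3 → ∃[ a ] ∃[ b ] ∃[ c ] IsTriple e a b c
enumerate {e = e} size with member e size
... | a , a∈e = a , enumerateFrom size a∈e

swapLast : ∀ {n} {e : Subset n} {a b c : Fin n} → IsTriple e a b c → IsTriple e a c b
swapLast (isTriple a≢b a≢c b≢c a∈e b∈e c∈e covers) =
  isTriple a≢c a≢b (≢-sym b≢c) a∈e c∈e b∈e λ z∈e → swap (covers z∈e)
  where
  swap : ∀ {z} {a b c : Fin _} → z ≡ a ⊎ z ≡ b ⊎ z ≡ c → z ≡ a ⊎ z ≡ c ⊎ z ≡ b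
  swap (inj₁ p) = inj₁ p
  swap (inj₂ (inj₁ p)) = inj₂ (inj₂ p)
  swap (inj₂ (inj₂ p)) = inj₂ (inj₁ p)

∈triple⁺ : ∀ {n} {a b c z : Fin n} → z ≡ a ⊎ z ≡ b ⊎ z ≡ c → z ∈ triple a b c
∈triple⁺ {a = a} (inj₁ refl) = x∈p∪q⁺ (inj₁ (x∈⁅x⁆ a))
∈triple⁺ {b = b} (inj₂ (inj₁ refl)) = x∈p∪q⁺ (inj₂ (x∈p∪q⁺ (inj₁ (x∈⁅x⁆ b))))
∈triple⁺ {c = c} (inj₂ (inj₂ refl)) = x∈p∪q⁺ (inj₂ (x∈p∪q⁺ (inj₂ (x∈⁅x⁆ c))))

∈triple⁻ : ∀ {n} {a b c z : Fin n} → z ∈ triple a b c → z ≡ a ⊎ z ≡ b ⊎ z ≡ c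
∈triple⁻ {a = a} {b} {c} m with x∈p∪q⁻ ⁅ a ⁆ (⁅ b ⁆ ∪ ⁅ c ⁆) m
... | inj₁ m₁ = inj₁ (x∈⁅y⁆⇒x≡y a m₁)
... | inj₂ m₂ with x∈p∪q⁻ ⁅ b ⁆ ⁅ c ⁆ m₂
...   | inj₁ m₃ = inj₂ (inj₁ (x∈⁅y⁆⇒x≡y b m₃))
...   | inj₂ m₃ = inj₂ (inj₂ (x∈⁅y⁆⇒x≡y c m₃))

IsTriple⇒≡triple : ∀ {n} {e : Subset n} {a b c : Fin n} → IsTriple e a b c → e ≡ triple a b c
IsTriple⇒≡triple {e = e} {a} {b} {c} t = ⊆-antisym (λ z∈e → ∈triple⁺ (covers z∈e)) triple⊆e
  where
  open IsTriple t
  triple⊆e : ∀ {z} → z ∈ triple a b c → z ∈ e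
  triple⊆e m with ∈triple⁻ m
  ... | inj₁ refl = ∈₁
  ... | inj₂ (inj₁ refl) = ∈₂
  ... | inj₂ (inj₂ refl) = ∈₃

sharePair? : ∀ {n} {A B : Subset n} {y a a' b b' : Fin n} →
  IsTriple A y a a' → IsTriple B y b b' →
  (∃[ q ] ∃[ r ] ∃[ s ] IsTriple A y q r × IsTriple B y q s) ⊎
  (a ≢ b × a ≢ b' × a' ≢ b × a' ≢ b')
sharePair? {a = a} {a'} {b} {b'} tA tB with a ≟ b | a ≟ b' | a' ≟ b | a' ≟ b'
... | yes refl | _ | _ | _ = inj₁ (_ , _ , _ , tA , tB)
... | no _ | yes refl | _ | _ = inj₁ (_ , _ , _ , tA , swapLast tB)
... | no _ | no _ | yes refl | _ = inj₁ (_ , _ , _ , swapLast tA , tB)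
... | no _ | no _ | no _ | yes refl = inj₁ (_ , _ , _ , swapLast tA , swapLast tB)
... | no a≢b | no a≢b' | no a'≢b | no a'≢b' = inj₂ (a≢b , a≢b' , a'≢b , a'≢b')

OnlyAvoiding₁ : ∀ {n} → Family n → Fin n → Subset n → Set
OnlyAvoiding₁ H x A = ∀ e → EdgeOfMinus H x e → e ≡ A

OnlyAvoiding₂ : ∀ {n} → Family n → Fin n → Subset n → Subset n → Set
OnlyAvoiding₂ H x A B = ∀ e → EdgeOfMinus H x e → e ≡ A ⊎ e ≡ B

data AvoidingEdges {n} (H : Family n) (x : Fin n) : Set where
  none : (∀ e → IsEdge H e → x ∈ e) → AvoidingEdges H x
  one : ∀ A → EdgeOfMinus H x A → OnlyAvoiding₁ H x A → AvoidingEdges H x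
  two : ∀ A B → EdgeOfMinus H x A → EdgeOfMinus H x B → A ≢ B →
        OnlyAvoiding₂ H x A B → AvoidingEdges H x

edgeOfMinus? : ∀ {n} (H : Family n) (x : Fin n) → Decidable (EdgeOfMinus H x)
edgeOfMinus? H x e = (H e Bool.≟ true) ×-dec ¬? (x ∈? e)

avoidingEdges : ∀ {n} (H : Family n) (x : Fin n) → AtMostTwo (EdgeOfMinus H x) →
  AvoidingEdges H x
avoidingEdges H x atMostTwo with anySubset? (edgeOfMinus? H x)
... | no noA = none λ e he → decidable-stable (x ∈? e) λ x∉e → noA (e , he , x∉e)
... | yes (A , A∉) with anySubset? {P = λ e → EdgeOfMinus H x e × e ≢ A}
                                  (λ e → edgeOfMinus? H x e ×-dec ¬? (≡-dec Bool._≟_ e A))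
...   | no noB = one A A∉ λ e e∉ → decidable-stable (≡-dec Bool._≟_ e A) λ e≢A → noB (e , e∉ , e≢A)
...   | yes (B , B∉ , B≢A) = two A B A∉ B∉ (≢-sym B≢A) only
  where
  only : OnlyAvoiding₂ H x A B
  only e e∉ with atMostTwo e A B e∉ A∉ B∉
  ... | inj₁ e≡A = inj₁ e≡A
  ... | inj₂ (inj₁ e≡B) = inj₂ e≡B
  ... | inj₂ (inj₂ A≡B) = contradiction (sym A≡B) B≢A

module AroundVertex {n} {H : Family n} (uniform : Is3Graph H) (intersecting : Intersecting H)
                    (x : Fin n) where

  hits : ∀ {e A a b c} → IsEdge H e → IsEdge H A → IsTriple A a b c → a ∈ e ⊎ b ∈ e ⊎ c ∈ e
  hits {e} {A} he hA t with intersecting e A he hA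
  ... | z , z∈e∩A with x∈p∩q⁻ e A z∈e∩A
  ...   | z∈e , z∈A with IsTriple.covers t z∈A
  ...     | inj₁ refl = inj₁ z∈e
  ...     | inj₂ (inj₁ refl) = inj₂ (inj₁ z∈e)
  ...     | inj₂ (inj₂ refl) = inj₂ (inj₂ z∈e)

  avoids : ∀ {A z} → x ∉ A → z ∈ A → x ≢ z
  avoids x∉A z∈A refl = x∉A z∈A

  edgeThrough : ∀ {e z w} → IsEdge H e → x ∈ e → z ∈ e → w ∈ e →
    x ≢ z → x ≢ w → z ≢ w → e ≡ triple x z w
  edgeThrough {e} he x∈e z∈e w∈e x≢z x≢w z≢w =
    IsTriple⇒≡triple (fromSize3 (uniform e he) x≢z x≢w z≢w x∈e z∈e w∈e)

  oneAvoiding⇒H₁ : ∀ {A a b c} → EdgeOfMinus H x A → IsTriple A a b c →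
    OnlyAvoiding₁ H x A → ContainedInH₁ H
  oneAvoiding⇒H₁ {A} {a} {b} {c} (hA , x∉A) t only = x , a , b , c , distinct , edges
    where
    open IsTriple t
    distinct : Unique (x ∷ a ∷ b ∷ c ∷ [])
    distinct = (avoids x∉A ∈₁ ∷ avoids x∉A ∈₂ ∷ avoids x∉A ∈₃ ∷ [])
             ∷ (≢₁₂ ∷ ≢₁₃ ∷ []) ∷ (≢₂₃ ∷ []) ∷ [] ∷ []
    edges : ∀ e → IsEdge H e → inH₁ x a b c e
    edges e he with x ∈? e
    ... | no x∉e = inj₂ (inj₂ (inj₂ (trans (only e (he , x∉e)) (IsTriple⇒≡triple t))))
    ... | yes x∈e with hits he hA t
    ...   | inj₁ a∈e = inj₁ (x∈e , a∈e)
    ...   | inj₂ (inj₁ b∈e) = inj₂ (inj₁ (x∈e , b∈e))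
    ...   | inj₂ (inj₂ c∈e) = inj₂ (inj₂ (inj₁ (x∈e , c∈e)))

  sharingPair⇒H₂ : ∀ {A B p q r s} → EdgeOfMinus H x A → EdgeOfMinus H x B → A ≢ B →
    OnlyAvoiding₂ H x A B → IsTriple A p q r → IsTriple B p q s → ContainedInH₂ H
  sharingPair⇒H₂ {A} {B} {p} {q} {r} {s} (hA , x∉A) (hB , x∉B) A≢B only tA tB =
    x , p , q , r , s , distinct , edges
    where
    open IsTriple tA
    s∈B : s ∈ B
    s∈B = IsTriple.∈₃ tB
    r≢s : r ≢ s
    r≢s refl = A≢B (trans (IsTriple⇒≡triple tA) (sym (IsTriple⇒≡triple tB)))
    distinct : Unique (x ∷ p ∷ q ∷ r ∷ s ∷ [])
    distinct = (avoids x∉A ∈₁ ∷ avoids x∉A ∈₂ ∷ avoids x∉A ∈₃ ∷ avoids x∉B s∈B ∷ [])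
             ∷ (≢₁₂ ∷ ≢₁₃ ∷ IsTriple.≢₁₃ tB ∷ []) ∷ (≢₂₃ ∷ IsTriple.≢₂₃ tB ∷ [])
             ∷ (r≢s ∷ []) ∷ [] ∷ []
    edges : ∀ e → IsEdge H e → inH₂ x p q r s e
    edges e he with x ∈? e
    ... | no x∉e with only e (he , x∉e)
    ...   | inj₁ e≡A = inj₂ (inj₂ (inj₁ (trans e≡A (IsTriple⇒≡triple tA))))
    ...   | inj₂ e≡B = inj₂ (inj₂ (inj₂ (inj₁ (trans e≡B (IsTriple⇒≡triple tB)))))
    edges e he | yes x∈e with hits he hA tA | hits he hB tB
    ... | inj₁ p∈e | _ = inj₁ (x∈e , p∈e)
    ... | inj₂ (inj₁ q∈e) | _ = inj₂ (inj₁ (x∈e , q∈e))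
    ... | _ | inj₁ p∈e = inj₁ (x∈e , p∈e)
    ... | _ | inj₂ (inj₁ q∈e) = inj₂ (inj₁ (x∈e , q∈e))
    ... | inj₂ (inj₂ r∈e) | inj₂ (inj₂ s∈e) = inj₂ (inj₂ (inj₂ (inj₂
          (edgeThrough he x∈e r∈e s∈e (avoids x∉A ∈₃) (avoids x∉B s∈B) r≢s))))

  meetingOnce⇒H₄ : ∀ {A B y a a' b b'} → EdgeOfMinus H x A → EdgeOfMinus H x B →
    OnlyAvoiding₂ H x A B → IsTriple A y a a' → IsTriple B y b b' →
    a ≢ b → a ≢ b' → a' ≢ b → a' ≢ b' → ContainedInH₄ H
  meetingOnce⇒H₄ {A} {B} {y} {a} {a'} {b} {b'} (hA , x∉A) (hB , x∉B) only tA tB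
                 a≢b a≢b' a'≢b a'≢b' =
    y , x , a , a' , b , b' , distinct , edges
    where
    open IsTriple tA
    open IsTriple tB using () renaming (≢₁₂ to y≢b; ≢₁₃ to y≢b'; ≢₂₃ to b≢b'; ∈₂ to b∈B; ∈₃ to b'∈B)
    x≢a : x ≢ a
    x≢a = avoids x∉A ∈₂
    x≢a' : x ≢ a'
    x≢a' = avoids x∉A ∈₃
    x≢b : x ≢ b
    x≢b = avoids x∉B b∈B
    x≢b' : x ≢ b'
    x≢b' = avoids x∉B b'∈B
    distinct : Unique (y ∷ x ∷ a ∷ a' ∷ b ∷ b' ∷ [])
    distinct = (≢-sym (avoids x∉A ∈₁) ∷ ≢₁₂ ∷ ≢₁₃ ∷ y≢b ∷ y≢b' ∷ [])
             ∷ (x≢a ∷ x≢a' ∷ x≢b ∷ x≢b' ∷ []) ∷ (≢₂₃ ∷ a≢b ∷ a≢b' ∷ [])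
             ∷ (a'≢b ∷ a'≢b' ∷ []) ∷ (b≢b' ∷ []) ∷ [] ∷ []
    edges : ∀ e → IsEdge H e → inH₄ y x a a' b b' e
    edges e he with x ∈? e
    ... | no x∉e with only e (he , x∉e)
    ...   | inj₁ e≡A = inj₂ (inj₁ (trans e≡A (IsTriple⇒≡triple tA)))
    ...   | inj₂ e≡B = inj₂ (inj₂ (inj₁ (trans e≡B (IsTriple⇒≡triple tB))))
    edges e he | yes x∈e with hits he hA tA | hits he hB tB
    ... | inj₁ y∈e | _ = inj₁ (y∈e , x∈e)
    ... | _ | inj₁ y∈e = inj₁ (y∈e , x∈e)
    ... | inj₂ (inj₁ a∈e) | inj₂ (inj₁ b∈e) =
          inj₂ (inj₂ (inj₂ (inj₁ (edgeThrough he x∈e a∈e b∈e x≢a x≢b a≢b))))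
    ... | inj₂ (inj₁ a∈e) | inj₂ (inj₂ b'∈e) =
          inj₂ (inj₂ (inj₂ (inj₂ (inj₁ (edgeThrough he x∈e a∈e b'∈e x≢a x≢b' a≢b')))))
    ... | inj₂ (inj₂ a'∈e) | inj₂ (inj₁ b∈e) =
          inj₂ (inj₂ (inj₂ (inj₂ (inj₂ (inj₁ (edgeThrough he x∈e a'∈e b∈e x≢a' x≢b a'≢b))))))
    ... | inj₂ (inj₂ a'∈e) | inj₂ (inj₂ b'∈e) =
          inj₂ (inj₂ (inj₂ (inj₂ (inj₂ (inj₂ (edgeThrough he x∈e a'∈e b'∈e x≢a' x≢b' a'≢b'))))))

  twoAvoiding⇒H₂⊎H₄ : ∀ {A B} → EdgeOfMinus H x A → EdgeOfMinus H x B → A ≢ B →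
    OnlyAvoiding₂ H x A B → ContainedInH₂ H ⊎ ContainedInH₄ H
  twoAvoiding⇒H₂⊎H₄ {A} {B} A∉ B∉ A≢B only with intersecting A B (proj₁ A∉) (proj₁ B∉)
  ... | y , y∈A∩B with x∈p∩q⁻ A B y∈A∩B
  ...   | y∈A , y∈B
          with enumerateFrom (uniform A (proj₁ A∉)) y∈A | enumerateFrom (uniform B (proj₁ B∉)) y∈B
  ...     | _ , _ , tA | _ , _ , tB with sharePair? tA tB
  ...       | inj₁ (_ , _ , _ , tA' , tB') = inj₁ (sharingPair⇒H₂ A∉ B∉ A≢B only tA' tB')
  ...       | inj₂ (a≢b , a≢b' , a'≢b , a'≢b') =
                inj₂ (meetingOnce⇒H₄ A∉ B∉ only tA tB a≢b a≢b' a'≢b a'≢b')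

  fromAvoidingEdges : AvoidingEdges H x →
    ContainedInH H ⊎ ContainedInH₀ H ⊎ ContainedInH₁ H ⊎ ContainedInH₂ H ⊎ ContainedInH₄ H
  fromAvoidingEdges (none allThroughX) = inj₁ (x , allThroughX)
  fromAvoidingEdges (one A A∉ only) with enumerate (uniform A (proj₁ A∉))
  ... | _ , _ , _ , tA = inj₂ (inj₂ (inj₁ (oneAvoiding⇒H₁ A∉ tA only)))
  fromAvoidingEdges (two A B A∉ B∉ A≢B only) = inj₂ (inj₂ (inj₂ (twoAvoiding⇒H₂⊎H₄ A∉ B∉ A≢B only)))

lemma2 : (n : ℕ) → 6 ≤ n → (H : Family n) → Is3Graph H → Intersecting H →
    (x : Fin n) → AtMostTwo (EdgeOfMinus H x) →
    ContainedInH H ⊎ ContainedInH₀ H ⊎ ContainedInH₁ H ⊎ ContainedInH₂ H ⊎ ContainedInH₄ H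
lemma2 _ _ H uniform intersecting x atMostTwo =
  AroundVertex.fromAvoidingEdges uniform intersecting x (avoidingEdges H x atMostTwo)
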